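{- Let $\mathcal{C}_1$ and $\mathcal{C}_2$ be symmetric monoidal categories, each having an initial object $0$ satisfying $A\otimes 0\simeq 0$ for all objects $A$, and let $M_i$ be a monoid in $\mathcal{C}_i$ for $i=1,2$. Then there exist a symmetric monoidal category $\mathcal{C}$, a monoid $M$ in $\mathcal{C}$, and central idempotents $u_1,u_2$ of $\mathcal{C}$, together with isomorphisms of monoidal categories $\mathcal{C}|_{u_i}\simeq\mathcal{C}_i$ ($i=1,2$) under which $M_i$ corresponds to $\mathcal{C}|_{u_i\leq 1}(M)$.
   Context: In a symmetric monoidal category $\mathcal{C}$ with unit $I$ and unitors $\lambda,\rho$, a central idempotent is a morphism $u\colon U\to I$ such that $\rho_U\circ(U\otimes u)=\lambda_U\circ(u\otimes U)\colon U\otimes U\to U$ and this morphism is invertible. For a central idempotent $u$, $\mathcal{C}|_u$ is the symmetric monoidal category with the objects of $\mathcal{C}$, morphisms $A\to B$ being morphisms $A\otimes U\to B$ of $\mathcal{C}$, composition of $f\colon A\otimes U\to B$ and $g\colon B\otimes U\to C$ given by $g\circ(f\otimes U)\circ(A\otimes U\otimes u)^{ -1}$, identity $A\otimes u$, tensor of objects as in $\mathcal{C}$, tensor of $f\colon A\otimes U\to B$, $f'\colon A'\otimes U\to B'$ given by $(f\otimes f')\circ(A\otimes\sigma_{A',U}\otimes U)\circ(A\otimes A'\otimes U\otimes u)^{ -1}$. Since $u\leq 1=\mathrm{id}_I$ via $m=u$, the functor $\mathcal{C}|_{u\leq 1}\colon\mathcal{C}\cong\mathcal{C}|_1\to\mathcal{C}|_u$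 is $A\mapsto A$, $f\mapsto f\circ(A\otimes u)$; it is strict monoidal and so sends monoids to monoids. -}

module Defs where

open import Level using (Level; _⊔_) renaming (suc to lsuc)
open import Relation.Binary using (Rel; IsEquivalence)
open import Data.Product using (Σ; _×_; _,_)

record SymMonCat (o ℓ e : Level) : Set (lsuc (o ⊔ ℓ ⊔ e)) where
  infixr 9 _∘_
  infix 4 _≈_ _⇒_
  infixr 10 _⊗₀_ _⊗₁_
  field
    Obj : Set o
    _⇒_ : Obj → Obj → Set ℓ
    _≈_ : ∀ {A B} → Rel (A ⇒ B) e
    ≈-equiv : ∀ {A B} → IsEquivalence (_≈_ {A} {B})
    id : ∀ {A} → A ⇒ A
    _∘_ : ∀ {A B C} → B ⇒ C → A ⇒ B → A ⇒ C
    assoc : ∀ {A B C D} {f : A ⇒ B} {g : B ⇒ C} {h : C ⇒ D} →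
            (h ∘ g) ∘ f ≈ h ∘ (g ∘ f)
    identityˡ : ∀ {A B} {f : A ⇒ B} → id ∘ f ≈ f
    identityʳ : ∀ {A B} {f : A ⇒ B} → f ∘ id ≈ f
    ∘-resp-≈ : ∀ {A B C} {f h : B ⇒ C} {g i : A ⇒ B} →
               f ≈ h → g ≈ i → f ∘ g ≈ h ∘ i
    _⊗₀_ : Obj → Obj → Obj
    _⊗₁_ : ∀ {A B C D} → A ⇒ B → C ⇒ D → (A ⊗₀ C) ⇒ (B ⊗₀ D)
    ⊗-identity : ∀ {A B} → id {A} ⊗₁ id {B} ≈ id
    ⊗-homomorphism : ∀ {A B C D E F} {f : A ⇒ B} {g : B ⇒ C} {h : D ⇒ E} {i : E ⇒ F} →
                     (g ∘ f) ⊗₁ (i ∘ h) ≈ (g ⊗₁ i) ∘ (f ⊗₁ h)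
    ⊗-resp-≈ : ∀ {A B C D} {f g : A ⇒ B} {h i : C ⇒ D} →
               f ≈ g → h ≈ i → f ⊗₁ h ≈ g ⊗₁ i
    unit : Obj
    λ⇒ : ∀ {A} → unit ⊗₀ A ⇒ A
    λ⇐ : ∀ {A} → A ⇒ unit ⊗₀ A
    ρ⇒ : ∀ {A} → A ⊗₀ unit ⇒ A
    ρ⇐ : ∀ {A} → A ⇒ A ⊗₀ unit
    α⇒ : ∀ {A B C} → (A ⊗₀ B) ⊗₀ C ⇒ A ⊗₀ (B ⊗₀ C)
    α⇐ : ∀ {A B C} → A ⊗₀ (B ⊗₀ C) ⇒ (A ⊗₀ B) ⊗₀ C
    σ : ∀ {A B} → A ⊗₀ B ⇒ B ⊗₀ A
    λ-isoˡ : ∀ {A} → λ⇐ ∘ λ⇒ {A} ≈ id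
    λ-isoʳ : ∀ {A} → λ⇒ ∘ λ⇐ {A} ≈ id
    ρ-isoˡ : ∀ {A} → ρ⇐ ∘ ρ⇒ {A} ≈ id
    ρ-isoʳ : ∀ {A} → ρ⇒ ∘ ρ⇐ {A} ≈ id
    α-isoˡ : ∀ {A B C} → α⇐ ∘ α⇒ {A} {B} {C} ≈ id
    α-isoʳ : ∀ {A B C} → α⇒ ∘ α⇐ {A} {B} {C} ≈ id
    λ-natural : ∀ {A B} {f : A ⇒ B} → λ⇒ ∘ (id ⊗₁ f) ≈ f ∘ λ⇒
    ρ-natural : ∀ {A B} {f : A ⇒ B} → ρ⇒ ∘ (f ⊗₁ id) ≈ f ∘ ρ⇒
    α-natural : ∀ {A B C D E F} {f : A ⇒ B} {g : C ⇒ D} {h : E ⇒ F} →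
                α⇒ ∘ ((f ⊗₁ g) ⊗₁ h) ≈ (f ⊗₁ (g ⊗₁ h)) ∘ α⇒
    σ-natural : ∀ {A B C D} {f : A ⇒ B} {g : C ⇒ D} →
                σ ∘ (f ⊗₁ g) ≈ (g ⊗₁ f) ∘ σ
    triangle : ∀ {A B} → (id {A} ⊗₁ λ⇒ {B}) ∘ α⇒ ≈ ρ⇒ ⊗₁ id
    pentagon : ∀ {A B C D} →
               (id {A} ⊗₁ α⇒ {B} {C} {D}) ∘ α⇒ ∘ (α⇒ ⊗₁ id) ≈ α⇒ ∘ α⇒
    hexagon : ∀ {A B C} →
              (id {B} ⊗₁ σ {A} {C}) ∘ α⇒ ∘ (σ ⊗₁ id) ≈ α⇒ ∘ σ ∘ α⇒
    σ-involutive : ∀ {A B} → σ {B} {A} ∘ σ {A} {B} ≈ id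

record Iso {o ℓ e} (C : SymMonCat o ℓ e) (A B : SymMonCat.Obj C) : Set (ℓ ⊔ e) where
  open SymMonCat C
  field
    to : A ⇒ B
    from : B ⇒ A
    isoˡ : from ∘ to ≈ id
    isoʳ : to ∘ from ≈ id

record HasAbsorbingInitial {o ℓ e} (C : SymMonCat o ℓ e) : Set (o ⊔ ℓ ⊔ e) where
  open SymMonCat C
  field
    zero : Obj
    ! : ∀ {A} → zero ⇒ A
    !-unique : ∀ {A} (f : zero ⇒ A) → ! ≈ f
    absorb : ∀ (A : Obj) → Iso C (A ⊗₀ zero) zero

record Monoid {o ℓ e} (C : SymMonCat o ℓ e) : Set (o ⊔ ℓ ⊔ e) where
  open SymMonCat C
  field
    Carrier : Obj
    μ : Carrier ⊗₀ Carrier ⇒ Carrier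
    η : unit ⇒ Carrier
    μ-assoc : μ ∘ (μ ⊗₁ id) ≈ μ ∘ (id ⊗₁ μ) ∘ α⇒
    μ-identityˡ : μ ∘ (η ⊗₁ id) ≈ λ⇒
    μ-identityʳ : μ ∘ (id ⊗₁ η) ≈ ρ⇒

record CentralIdem {o ℓ e} (C : SymMonCat o ℓ e) : Set (o ⊔ ℓ ⊔ e) where
  open SymMonCat C
  field
    U : Obj
    u : U ⇒ unit
    central : ρ⇒ ∘ (id ⊗₁ u) ≈ λ⇒ ∘ (u ⊗₁ id)
    inv : U ⇒ U ⊗₀ U
    inv-isoˡ : inv ∘ (ρ⇒ ∘ (id ⊗₁ u)) ≈ id
    inv-isoʳ : (ρ⇒ ∘ (id ⊗₁ u)) ∘ inv ≈ id

module Restrict {o ℓ e} (C : SymMonCat o ℓ e) (c : CentralIdem C) where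
  open SymMonCat C
  open CentralIdem c

  -- morphisms A → B in C|_u
  Hom : Obj → Obj → Set ℓ
  Hom A B = A ⊗₀ U ⇒ B

  idᵤ : ∀ {A} → Hom A A
  idᵤ = ρ⇒ ∘ (id ⊗₁ u)

  -- composition g ∘ (f ⊗ U) ∘ (A ⊗ U ⊗ u)⁻¹
  _∘ᵤ_ : ∀ {A B D} → Hom B D → Hom A B → Hom A D
  g ∘ᵤ f = g ∘ (f ⊗₁ id) ∘ α⇐ ∘ (id ⊗₁ inv)

  -- (A ⊗ A') ⊗ (U ⊗ U) → (A ⊗ U) ⊗ (A' ⊗ U), i.e. A ⊗ σ_{A',U} ⊗ U
  shuffle : ∀ {A A'} → (A ⊗₀ A') ⊗₀ (U ⊗₀ U) ⇒ (A ⊗₀ U) ⊗₀ (A' ⊗₀ U)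
  shuffle = α⇐ ∘ (id ⊗₁ (α⇒ ∘ (σ ⊗₁ id) ∘ α⇐)) ∘ α⇒

  _⊗ᵤ_ : ∀ {A B A' B'} → Hom A B → Hom A' B' → Hom (A ⊗₀ A') (B ⊗₀ B')
  f ⊗ᵤ f' = (f ⊗₁ f') ∘ shuffle ∘ (id ⊗₁ inv)

  -- the functor C|_{u ≤ 1} : C → C|_u, f ↦ f ∘ (A ⊗ u)
  embed : ∀ {A B} → A ⇒ B → Hom A B
  embed f = f ∘ ρ⇒ ∘ (id ⊗₁ u)

  αᵤ : ∀ {A B D} → Hom ((A ⊗₀ B) ⊗₀ D) (A ⊗₀ (B ⊗₀ D))
  αᵤ = embed α⇒
  λᵤ : ∀ {A} → Hom (unit ⊗₀ A) A
  λᵤ = embed λ⇒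
  ρᵤ : ∀ {A} → Hom (A ⊗₀ unit) A
  ρᵤ = embed ρ⇒

record MonEquiv {o ℓ e} (C : SymMonCat o ℓ e) (c : CentralIdem C)
                (D : SymMonCat o ℓ e) : Set (o ⊔ ℓ ⊔ e) where
  module C = SymMonCat C
  module D = SymMonCat D
  open Restrict C c
  field
    F₀ : C.Obj → D.Obj
    F₁ : ∀ {A B} → Hom A B → F₀ A D.⇒ F₀ B
    F-resp-≈ : ∀ {A B} {f g : Hom A B} → f C.≈ g → F₁ f D.≈ F₁ g
    F-identity : ∀ {A} → F₁ (idᵤ {A}) D.≈ D.id
    F-homomorphism : ∀ {A B E} {f : Hom A B} {g : Hom B E} →
                     F₁ (g ∘ᵤ f) D.≈ F₁ g D.∘ F₁ f
    φ : ∀ {A B} → F₀ A D.⊗₀ F₀ B D.⇒ F₀ (A C.⊗₀ B)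
    φ⁻ : ∀ {A B} → F₀ (A C.⊗₀ B) D.⇒ F₀ A D.⊗₀ F₀ B
    φ-isoˡ : ∀ {A B} → φ⁻ D.∘ φ {A} {B} D.≈ D.id
    φ-isoʳ : ∀ {A B} → φ {A} {B} D.∘ φ⁻ D.≈ D.id
    ψ : D.unit D.⇒ F₀ C.unit
    ψ⁻ : F₀ C.unit D.⇒ D.unit
    ψ-isoˡ : ψ⁻ D.∘ ψ D.≈ D.id
    ψ-isoʳ : ψ D.∘ ψ⁻ D.≈ D.id
    φ-natural : ∀ {A B A' B'} {f : Hom A B} {g : Hom A' B'} →
                φ D.∘ (F₁ f D.⊗₁ F₁ g) D.≈ F₁ (f ⊗ᵤ g) D.∘ φ
    associativity : ∀ {A B E} →
                    F₁ (αᵤ {A} {B} {E}) D.∘ φ D.∘ (φ D.⊗₁ D.id)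
                      D.≈ φ D.∘ (D.id D.⊗₁ φ) D.∘ D.α⇒
    unitaryˡ : ∀ {A} → F₁ (λᵤ {A}) D.∘ φ D.∘ (ψ D.⊗₁ D.id) D.≈ D.λ⇒
    unitaryʳ : ∀ {A} → F₁ (ρᵤ {A}) D.∘ φ D.∘ (D.id D.⊗₁ ψ) D.≈ D.ρ⇒
    faithful : ∀ {A B} {f g : Hom A B} → F₁ f D.≈ F₁ g → f C.≈ g
    full : ∀ {A B} (h : F₀ A D.⇒ F₀ B) → Σ (Hom A B) (λ f → F₁ f D.≈ h)
    essSurj : ∀ (X : D.Obj) → Σ C.Obj (λ A → Iso D (F₀ A) X)

-- "Under F, the monoid N of D corresponds to C|_{c ≤ 1}(M)": the image under F of the
-- monoid C|_{c≤1}(M) (with the strong monoidal structure of F) is isomorphic, as a monoid, to N.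
record MonoidCorr {o ℓ e} {C : SymMonCat o ℓ e} {c : CentralIdem C} {D : SymMonCat o ℓ e}
                  (F : MonEquiv C c D) (M : Monoid C) (N : Monoid D) : Set (ℓ ⊔ e) where
  open MonEquiv F
  open Restrict C c
  module M = Monoid M
  module N = Monoid N
  field
    h : F₀ M.Carrier D.⇒ N.Carrier
    h⁻ : N.Carrier D.⇒ F₀ M.Carrier
    h-isoˡ : h⁻ D.∘ h D.≈ D.id
    h-isoʳ : h D.∘ h⁻ D.≈ D.id
    h-μ : h D.∘ (F₁ (embed M.μ) D.∘ φ) D.≈ N.μ D.∘ (h D.⊗₁ h)
    h-η : h D.∘ (F₁ (embed M.η) D.∘ ψ) D.≈ N.η

-- Take C = C₁ × C₂ with the componentwise structure, M = M₁ × M₂, and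
-- u₁ = (id_I , 0 → I), u₂ = (0 → I , id_I).  Restricting along u₁ leaves the
-- first factor unchanged, since C|_{id_I} ≅ C via f ↦ f ∘ ρ⁻¹, and collapses the
-- second: a morphism B → B' of C₂|_0 is a map B ⊗ 0 → B', and B ⊗ 0 ≅ 0 is
-- initial, so there is exactly one.  Hence C|_{u₁} ≅ C₁, and the image of M is M₁;
-- symmetrically for u₂.
module Submission where

open import Relation.Binary using (Setoid; IsEquivalence)
open import Data.Product using (Σ; _×_; _,_; proj₁; proj₂)
import Relation.Binary.Reasoning.Setoid as SetoidReasoning
open import Defs

module Laws {o ℓ e} (C : SymMonCat o ℓ e) where
  open SymMonCat C

  hom-setoid : Obj → Obj → Setoid ℓ e
  hom-setoid A B = record { Carrier = A ⇒ B ; _≈_ = _≈_ ; isEquivalence = ≈-equiv }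

  open module HomReasoning {A B : Obj} = SetoidReasoning (hom-setoid A B) public
  open module HomEquivalence {A B : Obj} = IsEquivalence (≈-equiv {A} {B}) public
    using () renaming (refl to ≈-refl; sym to ≈-sym; trans to ≈-trans)

  ∘-resp-≈ˡ : ∀ {A B D} {f g : B ⇒ D} {h : A ⇒ B} → f ≈ g → f ∘ h ≈ g ∘ h
  ∘-resp-≈ˡ p = ∘-resp-≈ p ≈-refl

  ∘-resp-≈ʳ : ∀ {A B D} {f : B ⇒ D} {g h : A ⇒ B} → g ≈ h → f ∘ g ≈ f ∘ h
  ∘-resp-≈ʳ p = ∘-resp-≈ ≈-refl p

  ⊗-resp-≈ˡ : ∀ {A B X Y} {f g : A ⇒ B} {h : X ⇒ Y} → f ≈ g → f ⊗₁ h ≈ g ⊗₁ h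
  ⊗-resp-≈ˡ p = ⊗-resp-≈ p ≈-refl

  ⊗-resp-≈ʳ : ∀ {A B X Y} {f : A ⇒ B} {g h : X ⇒ Y} → g ≈ h → f ⊗₁ g ≈ f ⊗₁ h
  ⊗-resp-≈ʳ p = ⊗-resp-≈ ≈-refl p

  pullˡ : ∀ {A B D E} {a : D ⇒ E} {b : B ⇒ D} {c : B ⇒ E} {f : A ⇒ B} →
          a ∘ b ≈ c → a ∘ b ∘ f ≈ c ∘ f
  pullˡ p = ≈-trans (≈-sym assoc) (∘-resp-≈ˡ p)

  cancelˡ : ∀ {A B D} {a : D ⇒ B} {b : B ⇒ D} {f : A ⇒ B} → a ∘ b ≈ id → a ∘ b ∘ f ≈ f
  cancelˡ p = ≈-trans (pullˡ p) identityˡ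

  cancelʳ : ∀ {A B D} {a : B ⇒ D} {b : D ⇒ B} {f : B ⇒ A} → b ∘ a ≈ id → (f ∘ b) ∘ a ≈ f
  cancelʳ p = ≈-trans assoc (≈-trans (∘-resp-≈ʳ p) identityʳ)

  ∘-id⊗id : ∀ {A B D} {f : A ⊗₀ B ⇒ D} → f ∘ (id ⊗₁ id) ≈ f
  ∘-id⊗id = ≈-trans (∘-resp-≈ʳ ⊗-identity) identityʳ

  id⊗-∘ : ∀ {X A B D} {f : B ⇒ D} {g : A ⇒ B} → id {X} ⊗₁ (f ∘ g) ≈ (id ⊗₁ f) ∘ (id ⊗₁ g)
  id⊗-∘ = ≈-trans (⊗-resp-≈ˡ (≈-sym identityˡ)) ⊗-homomorphism

  ∘-⊗id : ∀ {X A B D} {f : B ⇒ D} {g : A ⇒ B} → (f ∘ g) ⊗₁ id {X} ≈ (f ⊗₁ id) ∘ (g ⊗₁ id)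
  ∘-⊗id = ≈-trans (⊗-resp-≈ʳ (≈-sym identityˡ)) ⊗-homomorphism

  ⊗-split : ∀ {A B A' B'} {f : A ⇒ B} {g : A' ⇒ B'} → f ⊗₁ g ≈ (f ⊗₁ id) ∘ (id ⊗₁ g)
  ⊗-split = ≈-trans (⊗-resp-≈ (≈-sym identityʳ) (≈-sym identityˡ)) ⊗-homomorphism

  ⊗id-inverse : ∀ {X A B} {a : A ⇒ B} {b : B ⇒ A} → b ∘ a ≈ id → (b ⊗₁ id {X}) ∘ (a ⊗₁ id) ≈ id
  ⊗id-inverse p = ≈-trans (≈-sym ∘-⊗id) (≈-trans (⊗-resp-≈ˡ p) ⊗-identity)

  id⊗-inverse : ∀ {X A B} {a : A ⇒ B} {b : B ⇒ A} → b ∘ a ≈ id → (id {X} ⊗₁ b) ∘ (id ⊗₁ a) ≈ id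
  id⊗-inverse p = ≈-trans (≈-sym id⊗-∘) (≈-trans (⊗-resp-≈ʳ p) ⊗-identity)

  split-mono-cancel : ∀ {A B D} {i : B ⇒ D} {j : D ⇒ B} {f g : A ⇒ B} →
                      j ∘ i ≈ id → i ∘ f ≈ i ∘ g → f ≈ g
  split-mono-cancel {i = i} {j} {f} {g} ji p = begin
    f           ≈⟨ cancelˡ ji ⟨
    j ∘ (i ∘ f) ≈⟨ ∘-resp-≈ʳ p ⟩
    j ∘ (i ∘ g) ≈⟨ cancelˡ ji ⟩
    g           ∎

  split-epi-cancel : ∀ {A B D} {i : A ⇒ B} {j : B ⇒ A} {f g : B ⇒ D} →
                     i ∘ j ≈ id → f ∘ i ≈ g ∘ i → f ≈ g
  split-epi-cancel {i = i} {j} {f} {g} ij p = begin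
    f           ≈⟨ cancelʳ ij ⟨
    (f ∘ i) ∘ j ≈⟨ ∘-resp-≈ˡ p ⟩
    (g ∘ i) ∘ j ≈⟨ cancelʳ ij ⟩
    g           ∎

  ∘-inverse-shift : ∀ {X Y Z} {a : Y ⇒ Z} {a⁻ : Z ⇒ Y} {b : X ⇒ Y} {c : X ⇒ Z} {c⁻ : Z ⇒ X} →
                    a ∘ b ≈ c → a⁻ ∘ a ≈ id → c ∘ c⁻ ≈ id → b ∘ c⁻ ≈ a⁻
  ∘-inverse-shift {a = a} {a⁻} {b} {c} {c⁻} p aa cc = begin
    b ∘ c⁻             ≈⟨ cancelˡ aa ⟨
    a⁻ ∘ (a ∘ (b ∘ c⁻)) ≈⟨ ∘-resp-≈ʳ (pullˡ p) ⟩
    a⁻ ∘ (c ∘ c⁻)       ≈⟨ ∘-resp-≈ʳ cc ⟩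
    a⁻ ∘ id             ≈⟨ identityʳ ⟩
    a⁻                  ∎

  ⊗id-injective : ∀ {A B} {f g : A ⇒ B} → f ⊗₁ id {unit} ≈ g ⊗₁ id → f ≈ g
  ⊗id-injective {f = f} {g} p = split-epi-cancel ρ-isoʳ (begin
    f ∘ ρ⇒            ≈⟨ ρ-natural ⟨
    ρ⇒ ∘ (f ⊗₁ id)    ≈⟨ ∘-resp-≈ʳ p ⟩
    ρ⇒ ∘ (g ⊗₁ id)    ≈⟨ ρ-natural ⟩
    g ∘ ρ⇒            ∎)

  id⊗-injective : ∀ {A B} {f g : A ⇒ B} → id {unit} ⊗₁ f ≈ id ⊗₁ g → f ≈ g
  id⊗-injective {f = f} {g} p = split-epi-cancel λ-isoʳ (begin
    f ∘ λ⇒            ≈⟨ λ-natural ⟨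
    λ⇒ ∘ (id ⊗₁ f)    ≈⟨ ∘-resp-≈ʳ p ⟩
    λ⇒ ∘ (id ⊗₁ g)    ≈⟨ λ-natural ⟩
    g ∘ λ⇒            ∎)

  id⊗ρ∘α≈ρ : ∀ {X Y} → (id {X} ⊗₁ ρ⇒ {Y}) ∘ α⇒ {X} {Y} {unit} ≈ ρ⇒
  id⊗ρ∘α≈ρ = ⊗id-injective (split-mono-cancel α-isoˡ (begin
    α⇒ ∘ (((id ⊗₁ ρ⇒) ∘ α⇒) ⊗₁ id)                  ≈⟨ ∘-resp-≈ʳ ∘-⊗id ⟩
    α⇒ ∘ ((id ⊗₁ ρ⇒) ⊗₁ id) ∘ (α⇒ ⊗₁ id)             ≈⟨ pullˡ α-natural ⟩
    ((id ⊗₁ (ρ⇒ ⊗₁ id)) ∘ α⇒) ∘ (α⇒ ⊗₁ id)           ≈⟨ assoc ⟩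
    (id ⊗₁ (ρ⇒ ⊗₁ id)) ∘ α⇒ ∘ (α⇒ ⊗₁ id)             ≈⟨ ∘-resp-≈ˡ (⊗-resp-≈ʳ triangle) ⟨
    (id ⊗₁ ((id ⊗₁ λ⇒) ∘ α⇒)) ∘ α⇒ ∘ (α⇒ ⊗₁ id)      ≈⟨ ∘-resp-≈ˡ id⊗-∘ ⟩
    ((id ⊗₁ (id ⊗₁ λ⇒)) ∘ (id ⊗₁ α⇒)) ∘ α⇒ ∘ (α⇒ ⊗₁ id) ≈⟨ assoc ⟩
    (id ⊗₁ (id ⊗₁ λ⇒)) ∘ (id ⊗₁ α⇒) ∘ α⇒ ∘ (α⇒ ⊗₁ id) ≈⟨ ∘-resp-≈ʳ pentagon ⟩
    (id ⊗₁ (id ⊗₁ λ⇒)) ∘ α⇒ ∘ α⇒                     ≈⟨ pullˡ (≈-sym α-natural) ⟩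
    (α⇒ ∘ ((id ⊗₁ id) ⊗₁ λ⇒)) ∘ α⇒                   ≈⟨ assoc ⟩
    α⇒ ∘ ((id ⊗₁ id) ⊗₁ λ⇒) ∘ α⇒                     ≈⟨ ∘-resp-≈ʳ (∘-resp-≈ˡ (⊗-resp-≈ˡ ⊗-identity)) ⟩
    α⇒ ∘ (id ⊗₁ λ⇒) ∘ α⇒                             ≈⟨ ∘-resp-≈ʳ triangle ⟩
    α⇒ ∘ (ρ⇒ ⊗₁ id)                                  ∎))

  λ∘α≈λ⊗id : ∀ {X Y} → λ⇒ {X ⊗₀ Y} ∘ α⇒ {unit} {X} {Y} ≈ λ⇒ ⊗₁ id
  λ∘α≈λ⊗id {X} {Y} =
    id⊗-injective (split-epi-cancel {i = α⇒ {unit} {unit ⊗₀ X} {Y}} α-isoʳ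
      (split-epi-cancel {i = α⇒ {unit} {unit} {X} ⊗₁ id {Y}} (⊗id-inverse α-isoʳ) (begin
        ((id ⊗₁ (λ⇒ ∘ α⇒)) ∘ α⇒) ∘ (α⇒ ⊗₁ id)                ≈⟨ assoc ⟩
        (id ⊗₁ (λ⇒ ∘ α⇒)) ∘ α⇒ ∘ (α⇒ ⊗₁ id)                  ≈⟨ ∘-resp-≈ˡ id⊗-∘ ⟩
        ((id ⊗₁ λ⇒) ∘ (id ⊗₁ α⇒)) ∘ α⇒ ∘ (α⇒ ⊗₁ id)          ≈⟨ assoc ⟩
        (id ⊗₁ λ⇒) ∘ (id ⊗₁ α⇒) ∘ α⇒ ∘ (α⇒ ⊗₁ id)            ≈⟨ ∘-resp-≈ʳ pentagon ⟩
        (id ⊗₁ λ⇒) ∘ α⇒ ∘ α⇒                                ≈⟨ pullˡ triangle ⟩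
        (ρ⇒ ⊗₁ id) ∘ α⇒                                     ≈⟨ ∘-resp-≈ˡ (⊗-resp-≈ʳ ⊗-identity) ⟨
        (ρ⇒ ⊗₁ (id ⊗₁ id)) ∘ α⇒                             ≈⟨ α-natural ⟨
        α⇒ ∘ ((ρ⇒ ⊗₁ id) ⊗₁ id)                             ≈⟨ ∘-resp-≈ʳ (⊗-resp-≈ˡ triangle) ⟨
        α⇒ ∘ (((id ⊗₁ λ⇒) ∘ α⇒) ⊗₁ id)                      ≈⟨ ∘-resp-≈ʳ ∘-⊗id ⟩
        α⇒ ∘ ((id ⊗₁ λ⇒) ⊗₁ id) ∘ (α⇒ ⊗₁ id)                ≈⟨ pullˡ α-natural ⟩
        ((id ⊗₁ (λ⇒ ⊗₁ id)) ∘ α⇒) ∘ (α⇒ ⊗₁ id)              ∎)))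

  λ≈ρ : λ⇒ {unit} ≈ ρ⇒
  λ≈ρ = ⊗id-injective (begin
    λ⇒ ⊗₁ id           ≈⟨ λ∘α≈λ⊗id ⟨
    λ⇒ ∘ α⇒            ≈⟨ ∘-resp-≈ˡ id⊗λ≈λ ⟨
    (id ⊗₁ λ⇒) ∘ α⇒    ≈⟨ triangle ⟩
    ρ⇒ ⊗₁ id           ∎)
    where
    id⊗λ≈λ : id {unit} ⊗₁ λ⇒ {unit} ≈ λ⇒
    id⊗λ≈λ = split-mono-cancel λ-isoˡ λ-natural

  λ∘σ≈ρ : ∀ {A} → λ⇒ {A} ∘ σ {A} {unit} ≈ ρ⇒
  λ∘σ≈ρ = ⊗id-injective (split-mono-cancel σ-involutive (begin
    σ ∘ ((λ⇒ ∘ σ) ⊗₁ id)                ≈⟨ ∘-resp-≈ʳ ∘-⊗id ⟩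
    σ ∘ (λ⇒ ⊗₁ id) ∘ (σ ⊗₁ id)          ≈⟨ ∘-resp-≈ʳ (∘-resp-≈ˡ λ∘α≈λ⊗id) ⟨
    σ ∘ (λ⇒ ∘ α⇒) ∘ (σ ⊗₁ id)           ≈⟨ ∘-resp-≈ʳ assoc ⟩
    σ ∘ λ⇒ ∘ α⇒ ∘ (σ ⊗₁ id)             ≈⟨ pullˡ (≈-sym λ-natural) ⟩
    (λ⇒ ∘ (id ⊗₁ σ)) ∘ α⇒ ∘ (σ ⊗₁ id)   ≈⟨ assoc ⟩
    λ⇒ ∘ (id ⊗₁ σ) ∘ α⇒ ∘ (σ ⊗₁ id)     ≈⟨ ∘-resp-≈ʳ hexagon ⟩
    λ⇒ ∘ α⇒ ∘ σ ∘ α⇒                    ≈⟨ pullˡ λ∘α≈λ⊗id ⟩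
    (λ⇒ ⊗₁ id) ∘ σ ∘ α⇒                 ≈⟨ pullˡ (≈-sym σ-natural) ⟩
    (σ ∘ (id ⊗₁ λ⇒)) ∘ α⇒               ≈⟨ assoc ⟩
    σ ∘ (id ⊗₁ λ⇒) ∘ α⇒                 ≈⟨ ∘-resp-≈ʳ triangle ⟩
    σ ∘ (ρ⇒ ⊗₁ id)                      ∎))

  α⇒∘ρ⇐≈id⊗ρ⇐ : ∀ {X Y} → α⇒ ∘ ρ⇐ {X ⊗₀ Y} ≈ id ⊗₁ ρ⇐
  α⇒∘ρ⇐≈id⊗ρ⇐ = ∘-inverse-shift id⊗ρ∘α≈ρ (id⊗-inverse ρ-isoˡ) ρ-isoʳ

  α⇐∘id⊗ρ⇐≈ρ⇐ : ∀ {X Y} → α⇐ ∘ (id ⊗₁ ρ⇐) ≈ ρ⇐ {X ⊗₀ Y}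
  α⇐∘id⊗ρ⇐≈ρ⇐ = ≈-trans (∘-resp-≈ʳ (≈-sym α⇒∘ρ⇐≈id⊗ρ⇐)) (cancelˡ α-isoˡ)

  α⇐∘id⊗λ⇐≈ρ⇐⊗id : ∀ {X Y} → α⇐ ∘ (id ⊗₁ λ⇐) ≈ ρ⇐ {X} ⊗₁ id {Y}
  α⇐∘id⊗λ⇐≈ρ⇐⊗id =
    ≈-trans (∘-resp-≈ʳ (≈-sym (∘-inverse-shift triangle (id⊗-inverse λ-isoˡ) (⊗id-inverse ρ-isoʳ))))
            (cancelˡ α-isoˡ)

  σ∘ρ⇐≈λ⇐ : ∀ {A} → σ ∘ ρ⇐ {A} ≈ λ⇐
  σ∘ρ⇐≈λ⇐ = ∘-inverse-shift λ∘σ≈ρ λ-isoˡ ρ-isoʳ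

  α⇒∘λ⇐⊗id≈λ⇐ : ∀ {X Y} → α⇒ ∘ (λ⇐ ⊗₁ id) ≈ λ⇐ {X ⊗₀ Y}
  α⇒∘λ⇐⊗id≈λ⇐ = ∘-inverse-shift λ∘α≈λ⊗id λ-isoˡ (⊗id-inverse λ-isoʳ)

  ρ⇐-natural : ∀ {A B} {f : A ⇒ B} → ρ⇐ ∘ f ≈ (f ⊗₁ id) ∘ ρ⇐
  ρ⇐-natural {f = f} = begin
    ρ⇐ ∘ f                       ≈⟨ cancelʳ ρ-isoʳ ⟨
    ((ρ⇐ ∘ f) ∘ ρ⇒) ∘ ρ⇐         ≈⟨ ∘-resp-≈ˡ assoc ⟩
    (ρ⇐ ∘ f ∘ ρ⇒) ∘ ρ⇐           ≈⟨ ∘-resp-≈ˡ (∘-resp-≈ʳ ρ-natural) ⟨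
    (ρ⇐ ∘ ρ⇒ ∘ (f ⊗₁ id)) ∘ ρ⇐   ≈⟨ ∘-resp-≈ˡ (cancelˡ ρ-isoˡ) ⟩
    (f ⊗₁ id) ∘ ρ⇐               ∎

module UnitRestriction {o ℓ e} (C : SymMonCat o ℓ e) where
  open SymMonCat C
  open Laws C

  unit-idem : CentralIdem C
  unit-idem = record
    { U = unit
    ; u = id
    ; central = ≈-trans ∘-id⊗id (≈-trans (≈-sym λ≈ρ) (≈-sym ∘-id⊗id))
    ; inv = ρ⇐
    ; inv-isoˡ = ≈-trans (∘-resp-≈ʳ ∘-id⊗id) ρ-isoˡ
    ; inv-isoʳ = ≈-trans (∘-resp-≈ˡ ∘-id⊗id) ρ-isoʳ
    }

  open Restrict C unit-idem

  restrict : ∀ {A B} → Hom A B → A ⇒ B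
  restrict f = f ∘ ρ⇐

  restrict-idᵤ : ∀ {A} → restrict (idᵤ {A}) ≈ id
  restrict-idᵤ = ≈-trans (∘-resp-≈ˡ ∘-id⊗id) ρ-isoʳ

  restrict-embed : ∀ {A B} {f : A ⇒ B} → restrict (embed f) ≈ f
  restrict-embed = ≈-trans assoc (≈-trans (∘-resp-≈ʳ restrict-idᵤ) identityʳ)

  restrict-∘ᵤ : ∀ {A B D} {f : Hom A B} {g : Hom B D} →
                restrict (g ∘ᵤ f) ≈ restrict g ∘ restrict f
  restrict-∘ᵤ {f = f} {g} = begin
    (g ∘ (f ⊗₁ id) ∘ α⇐ ∘ (id ⊗₁ ρ⇐)) ∘ ρ⇐  ≈⟨ ≈-trans assoc (∘-resp-≈ʳ (≈-trans assoc (∘-resp-≈ʳ assoc))) ⟩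
    g ∘ (f ⊗₁ id) ∘ α⇐ ∘ (id ⊗₁ ρ⇐) ∘ ρ⇐    ≈⟨ ∘-resp-≈ʳ (∘-resp-≈ʳ (pullˡ α⇐∘id⊗ρ⇐≈ρ⇐)) ⟩
    g ∘ (f ⊗₁ id) ∘ ρ⇐ ∘ ρ⇐                 ≈⟨ ∘-resp-≈ʳ (pullˡ (≈-sym ρ⇐-natural)) ⟩
    g ∘ (ρ⇐ ∘ f) ∘ ρ⇐                       ≈⟨ ≈-trans (∘-resp-≈ʳ assoc) (≈-sym assoc) ⟩
    (g ∘ ρ⇐) ∘ (f ∘ ρ⇐)                     ∎

  shuffle∘id⊗ρ⇐∘ρ⇐≈ρ⇐⊗ρ⇐ : ∀ {A A'} → shuffle ∘ (id ⊗₁ ρ⇐) ∘ ρ⇐ ≈ ρ⇐ {A} ⊗₁ ρ⇐ {A'}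
  shuffle∘id⊗ρ⇐∘ρ⇐≈ρ⇐⊗ρ⇐ = begin
    (α⇐ ∘ (id ⊗₁ τ) ∘ α⇒) ∘ (id ⊗₁ ρ⇐) ∘ ρ⇐   ≈⟨ ≈-trans assoc (∘-resp-≈ʳ assoc) ⟩
    α⇐ ∘ (id ⊗₁ τ) ∘ α⇒ ∘ (id ⊗₁ ρ⇐) ∘ ρ⇐     ≈⟨ ∘-resp-≈ʳ (∘-resp-≈ʳ α-past-ρ⇐) ⟩
    α⇐ ∘ (id ⊗₁ τ) ∘ (id ⊗₁ ((id ⊗₁ ρ⇐) ∘ ρ⇐)) ≈⟨ ∘-resp-≈ʳ (≈-sym id⊗-∘) ⟩
    α⇐ ∘ (id ⊗₁ (τ ∘ (id ⊗₁ ρ⇐) ∘ ρ⇐))        ≈⟨ ∘-resp-≈ʳ (⊗-resp-≈ʳ τ∘id⊗ρ⇐∘ρ⇐) ⟩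
    α⇐ ∘ (id ⊗₁ (λ⇐ ∘ ρ⇐))                   ≈⟨ ∘-resp-≈ʳ id⊗-∘ ⟩
    α⇐ ∘ (id ⊗₁ λ⇐) ∘ (id ⊗₁ ρ⇐)             ≈⟨ pullˡ α⇐∘id⊗λ⇐≈ρ⇐⊗id ⟩
    (ρ⇐ ⊗₁ id) ∘ (id ⊗₁ ρ⇐)                  ≈⟨ ⊗-split ⟨
    ρ⇐ ⊗₁ ρ⇐                                 ∎
    where
    τ : ∀ {A'} → A' ⊗₀ (unit ⊗₀ unit) ⇒ unit ⊗₀ (A' ⊗₀ unit)
    τ = α⇒ ∘ (σ ⊗₁ id) ∘ α⇐

    α-past-ρ⇐ : ∀ {A A'} → α⇒ ∘ (id ⊗₁ ρ⇐) ∘ ρ⇐ ≈ id {A} ⊗₁ ((id {A'} ⊗₁ ρ⇐) ∘ ρ⇐)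
    α-past-ρ⇐ = begin
      α⇒ ∘ (id ⊗₁ ρ⇐) ∘ ρ⇐                ≈⟨ ∘-resp-≈ʳ (∘-resp-≈ˡ (⊗-resp-≈ˡ ⊗-identity)) ⟨
      α⇒ ∘ ((id ⊗₁ id) ⊗₁ ρ⇐) ∘ ρ⇐        ≈⟨ pullˡ α-natural ⟩
      ((id ⊗₁ (id ⊗₁ ρ⇐)) ∘ α⇒) ∘ ρ⇐      ≈⟨ ≈-trans assoc (∘-resp-≈ʳ α⇒∘ρ⇐≈id⊗ρ⇐) ⟩
      (id ⊗₁ (id ⊗₁ ρ⇐)) ∘ (id ⊗₁ ρ⇐)     ≈⟨ id⊗-∘ ⟨
      id ⊗₁ ((id ⊗₁ ρ⇐) ∘ ρ⇐)             ∎

    τ∘id⊗ρ⇐∘ρ⇐ : ∀ {A'} → τ ∘ (id ⊗₁ ρ⇐) ∘ ρ⇐ ≈ λ⇐ ∘ ρ⇐ {A'}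
    τ∘id⊗ρ⇐∘ρ⇐ = begin
      (α⇒ ∘ (σ ⊗₁ id) ∘ α⇐) ∘ (id ⊗₁ ρ⇐) ∘ ρ⇐  ≈⟨ ≈-trans assoc (∘-resp-≈ʳ assoc) ⟩
      α⇒ ∘ (σ ⊗₁ id) ∘ α⇐ ∘ (id ⊗₁ ρ⇐) ∘ ρ⇐    ≈⟨ ∘-resp-≈ʳ (∘-resp-≈ʳ (pullˡ α⇐∘id⊗ρ⇐≈ρ⇐)) ⟩
      α⇒ ∘ (σ ⊗₁ id) ∘ ρ⇐ ∘ ρ⇐                ≈⟨ ∘-resp-≈ʳ (∘-resp-≈ʳ ρ⇐-natural) ⟩
      α⇒ ∘ (σ ⊗₁ id) ∘ (ρ⇐ ⊗₁ id) ∘ ρ⇐        ≈⟨ ∘-resp-≈ʳ (pullˡ (≈-trans (≈-sym ∘-⊗id) (⊗-resp-≈ˡ σ∘ρ⇐≈λ⇐))) ⟩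
      α⇒ ∘ (λ⇐ ⊗₁ id) ∘ ρ⇐                    ≈⟨ pullˡ α⇒∘λ⇐⊗id≈λ⇐ ⟩
      λ⇐ ∘ ρ⇐                                 ∎

  restrict-⊗ᵤ : ∀ {A B A' B'} {f : Hom A B} {g : Hom A' B'} →
                restrict (f ⊗ᵤ g) ≈ restrict f ⊗₁ restrict g
  restrict-⊗ᵤ {f = f} {g} = begin
    ((f ⊗₁ g) ∘ shuffle ∘ (id ⊗₁ ρ⇐)) ∘ ρ⇐  ≈⟨ ≈-trans assoc (∘-resp-≈ʳ assoc) ⟩
    (f ⊗₁ g) ∘ shuffle ∘ (id ⊗₁ ρ⇐) ∘ ρ⇐    ≈⟨ ∘-resp-≈ʳ shuffle∘id⊗ρ⇐∘ρ⇐≈ρ⇐⊗ρ⇐ ⟩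
    (f ⊗₁ g) ∘ (ρ⇐ ⊗₁ ρ⇐)                   ≈⟨ ⊗-homomorphism ⟨
    (f ∘ ρ⇐) ⊗₁ (g ∘ ρ⇐)                    ∎

  identity-iso : ∀ {A} → Iso C A A
  identity-iso = record { to = id ; from = id ; isoˡ = identityˡ ; isoʳ = identityˡ }

  restrict-embed-structure : ∀ {A B X} {f : A ⊗₀ B ⇒ X} →
                             restrict (embed f) ∘ id ∘ (id ⊗₁ id) ≈ f
  restrict-embed-structure = ≈-trans (∘-resp-≈ restrict-embed (≈-trans identityˡ ⊗-identity)) identityʳ

  unit-restriction : MonEquiv C unit-idem C
  unit-restriction = record
    { F₀ = λ A → A
    ; F₁ = restrict
    ; F-resp-≈ = ∘-resp-≈ˡ
    ; F-identity = restrict-idᵤ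
    ; F-homomorphism = restrict-∘ᵤ
    ; φ = id
    ; φ⁻ = id
    ; φ-isoˡ = identityˡ
    ; φ-isoʳ = identityˡ
    ; ψ = id
    ; ψ⁻ = id
    ; ψ-isoˡ = identityˡ
    ; ψ-isoʳ = identityˡ
    ; φ-natural = ≈-trans identityˡ (≈-trans (≈-sym restrict-⊗ᵤ) (≈-sym identityʳ))
    ; associativity = ≈-trans restrict-embed-structure
                        (≈-sym (≈-trans (pullˡ (≈-trans identityˡ ⊗-identity)) identityˡ))
    ; unitaryˡ = restrict-embed-structure
    ; unitaryʳ = restrict-embed-structure
    ; faithful = split-epi-cancel ρ-isoˡ
    ; full = λ h → h ∘ ρ⇒ , cancelʳ ρ-isoʳ
    ; essSurj = λ A → A , identity-iso
    }

  unit-restriction-monoid : (M : Monoid C) → MonoidCorr unit-restriction M M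
  unit-restriction-monoid M = record
    { h = id
    ; h⁻ = id
    ; h-isoˡ = identityˡ
    ; h-isoʳ = identityˡ
    ; h-μ = ≈-trans identityˡ (≈-trans identityʳ (≈-trans restrict-embed (≈-sym ∘-id⊗id)))
    ; h-η = ≈-trans identityˡ (≈-trans identityʳ restrict-embed)
    }

module AbsorbingInitial {o ℓ e} {C : SymMonCat o ℓ e} (H : HasAbsorbingInitial C) where
  open SymMonCat C
  open Laws C
  open HasAbsorbingInitial H

  from-zero-unique : ∀ {A} (f g : zero ⇒ A) → f ≈ g
  from-zero-unique f g = ≈-trans (≈-sym (!-unique f)) (!-unique g)

  from-⊗zero : ∀ {A B} → A ⊗₀ zero ⇒ B
  from-⊗zero {A} = ! ∘ Iso.to (absorb A)

  from-⊗zero-unique : ∀ {A B} (f g : A ⊗₀ zero ⇒ B) → f ≈ g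
  from-⊗zero-unique {A} f g = split-epi-cancel (Iso.isoˡ (absorb A))
    (from-zero-unique (f ∘ Iso.from (absorb A)) (g ∘ Iso.from (absorb A)))

  zero-idem : CentralIdem C
  zero-idem = record
    { U = zero
    ; u = !
    ; central = from-⊗zero-unique _ _
    ; inv = !
    ; inv-isoˡ = from-⊗zero-unique _ _
    ; inv-isoʳ = from-zero-unique _ _
    }

product : ∀ {o ℓ e} → SymMonCat o ℓ e → SymMonCat o ℓ e → SymMonCat o ℓ e
product C₁ C₂ = record
  { Obj = C₁.Obj × C₂.Obj
  ; _⇒_ = λ X Y → (proj₁ X C₁.⇒ proj₁ Y) × (proj₂ X C₂.⇒ proj₂ Y)
  ; _≈_ = λ f g → (proj₁ f C₁.≈ proj₁ g) × (proj₂ f C₂.≈ proj₂ g)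
  ; ≈-equiv = record
    { refl = L₁.≈-refl , L₂.≈-refl
    ; sym = λ (p , q) → L₁.≈-sym p , L₂.≈-sym q
    ; trans = λ (p , q) (p' , q') → L₁.≈-trans p p' , L₂.≈-trans q q'
    }
  ; id = C₁.id , C₂.id
  ; _∘_ = λ (f , g) (f' , g') → f C₁.∘ f' , g C₂.∘ g'
  ; assoc = C₁.assoc , C₂.assoc
  ; identityˡ = C₁.identityˡ , C₂.identityˡ
  ; identityʳ = C₁.identityʳ , C₂.identityʳ
  ; ∘-resp-≈ = λ (p , q) (p' , q') → C₁.∘-resp-≈ p p' , C₂.∘-resp-≈ q q'
  ; _⊗₀_ = λ (A , B) (A' , B') → A C₁.⊗₀ A' , B C₂.⊗₀ B'
  ; _⊗₁_ = λ (f , g) (f' , g') → f C₁.⊗₁ f' , g C₂.⊗₁ g'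
  ; ⊗-identity = C₁.⊗-identity , C₂.⊗-identity
  ; ⊗-homomorphism = C₁.⊗-homomorphism , C₂.⊗-homomorphism
  ; ⊗-resp-≈ = λ (p , q) (p' , q') → C₁.⊗-resp-≈ p p' , C₂.⊗-resp-≈ q q'
  ; unit = C₁.unit , C₂.unit
  ; λ⇒ = C₁.λ⇒ , C₂.λ⇒
  ; λ⇐ = C₁.λ⇐ , C₂.λ⇐
  ; ρ⇒ = C₁.ρ⇒ , C₂.ρ⇒
  ; ρ⇐ = C₁.ρ⇐ , C₂.ρ⇐
  ; α⇒ = C₁.α⇒ , C₂.α⇒
  ; α⇐ = C₁.α⇐ , C₂.α⇐
  ; σ = C₁.σ , C₂.σ
  ; λ-isoˡ = C₁.λ-isoˡ , C₂.λ-isoˡ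
  ; λ-isoʳ = C₁.λ-isoʳ , C₂.λ-isoʳ
  ; ρ-isoˡ = C₁.ρ-isoˡ , C₂.ρ-isoˡ
  ; ρ-isoʳ = C₁.ρ-isoʳ , C₂.ρ-isoʳ
  ; α-isoˡ = C₁.α-isoˡ , C₂.α-isoˡ
  ; α-isoʳ = C₁.α-isoʳ , C₂.α-isoʳ
  ; λ-natural = C₁.λ-natural , C₂.λ-natural
  ; ρ-natural = C₁.ρ-natural , C₂.ρ-natural
  ; α-natural = C₁.α-natural , C₂.α-natural
  ; σ-natural = C₁.σ-natural , C₂.σ-natural
  ; triangle = C₁.triangle , C₂.triangle
  ; pentagon = C₁.pentagon , C₂.pentagon
  ; hexagon = C₁.hexagon , C₂.hexagon
  ; σ-involutive = C₁.σ-involutive , C₂.σ-involutive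
  }
  where
  module C₁ = SymMonCat C₁
  module C₂ = SymMonCat C₂
  module L₁ = Laws C₁
  module L₂ = Laws C₂

module _ {o ℓ e} {C₁ C₂ : SymMonCat o ℓ e} where
  private
    module C₁ = SymMonCat C₁
    module C₂ = SymMonCat C₂

  product-monoid : Monoid C₁ → Monoid C₂ → Monoid (product C₁ C₂)
  product-monoid M₁ M₂ = record
    { Carrier = M₁.Carrier , M₂.Carrier
    ; μ = M₁.μ , M₂.μ
    ; η = M₁.η , M₂.η
    ; μ-assoc = M₁.μ-assoc , M₂.μ-assoc
    ; μ-identityˡ = M₁.μ-identityˡ , M₂.μ-identityˡ
    ; μ-identityʳ = M₁.μ-identityʳ , M₂.μ-identityʳ
    }
    where
    module M₁ = Monoid M₁
    module M₂ = Monoid M₂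

  product-idem : CentralIdem C₁ → CentralIdem C₂ → CentralIdem (product C₁ C₂)
  product-idem c₁ c₂ = record
    { U = c₁.U , c₂.U
    ; u = c₁.u , c₂.u
    ; central = c₁.central , c₂.central
    ; inv = c₁.inv , c₂.inv
    ; inv-isoˡ = c₁.inv-isoˡ , c₂.inv-isoˡ
    ; inv-isoʳ = c₁.inv-isoʳ , c₂.inv-isoʳ
    }
    where
    module c₁ = CentralIdem c₁
    module c₂ = CentralIdem c₂

  module _ {D : SymMonCat o ℓ e} where
    extend-by-zeroʳ : {c : CentralIdem C₁} → MonEquiv C₁ c D → (H : HasAbsorbingInitial C₂) →
                      MonEquiv (product C₁ C₂) (product-idem c (AbsorbingInitial.zero-idem H)) D
    extend-by-zeroʳ F H = record
      { F₀ = λ X → F.F₀ (proj₁ X)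
      ; F₁ = λ f → F.F₁ (proj₁ f)
      ; F-resp-≈ = λ p → F.F-resp-≈ (proj₁ p)
      ; F-identity = F.F-identity
      ; F-homomorphism = F.F-homomorphism
      ; φ = F.φ
      ; φ⁻ = F.φ⁻
      ; φ-isoˡ = F.φ-isoˡ
      ; φ-isoʳ = F.φ-isoʳ
      ; ψ = F.ψ
      ; ψ⁻ = F.ψ⁻
      ; ψ-isoˡ = F.ψ-isoˡ
      ; ψ-isoʳ = F.ψ-isoʳ
      ; φ-natural = F.φ-natural
      ; associativity = F.associativity
      ; unitaryˡ = F.unitaryˡ
      ; unitaryʳ = F.unitaryʳ
      ; faithful = λ p → F.faithful p , Z.from-⊗zero-unique _ _
      ; full = λ h → (proj₁ (F.full h) , Z.from-⊗zero) , proj₂ (F.full h)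
      ; essSurj = λ X → (proj₁ (F.essSurj X) , C₂.unit) , proj₂ (F.essSurj X)
      }
      where
      module F = MonEquiv F
      module Z = AbsorbingInitial H

    extend-by-zeroʳ-monoid : {c : CentralIdem C₁} {F : MonEquiv C₁ c D} {M₁ : Monoid C₁} {N : Monoid D} →
                             MonoidCorr F M₁ N → (H : HasAbsorbingInitial C₂) (M₂ : Monoid C₂) →
                             MonoidCorr (extend-by-zeroʳ F H) (product-monoid M₁ M₂) N
    extend-by-zeroʳ-monoid K H M₂ = record { MonoidCorr K }

    extend-by-zeroˡ : {c : CentralIdem C₂} → (H : HasAbsorbingInitial C₁) → MonEquiv C₂ c D →
                      MonEquiv (product C₁ C₂) (product-idem (AbsorbingInitial.zero-idem H) c) D
    extend-by-zeroˡ H F = record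
      { F₀ = λ X → F.F₀ (proj₂ X)
      ; F₁ = λ f → F.F₁ (proj₂ f)
      ; F-resp-≈ = λ p → F.F-resp-≈ (proj₂ p)
      ; F-identity = F.F-identity
      ; F-homomorphism = F.F-homomorphism
      ; φ = F.φ
      ; φ⁻ = F.φ⁻
      ; φ-isoˡ = F.φ-isoˡ
      ; φ-isoʳ = F.φ-isoʳ
      ; ψ = F.ψ
      ; ψ⁻ = F.ψ⁻
      ; ψ-isoˡ = F.ψ-isoˡ
      ; ψ-isoʳ = F.ψ-isoʳ
      ; φ-natural = F.φ-natural
      ; associativity = F.associativity
      ; unitaryˡ = F.unitaryˡ
      ; unitaryʳ = F.unitaryʳ
      ; faithful = λ p → Z.from-⊗zero-unique _ _ , F.faithful p
      ; full = λ h → (Z.from-⊗zero , proj₁ (F.full h)) , proj₂ (F.full h)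
      ; essSurj = λ X → (C₁.unit , proj₁ (F.essSurj X)) , proj₂ (F.essSurj X)
      }
      where
      module F = MonEquiv F
      module Z = AbsorbingInitial H

    extend-by-zeroˡ-monoid : {c : CentralIdem C₂} {F : MonEquiv C₂ c D} {M₂ : Monoid C₂} {N : Monoid D} →
                             (H : HasAbsorbingInitial C₁) (M₁ : Monoid C₁) → MonoidCorr F M₂ N →
                             MonoidCorr (extend-by-zeroˡ H F) (product-monoid M₁ M₂) N
    extend-by-zeroˡ-monoid H M₁ K = record { MonoidCorr K }

lemma5p2 : ∀ {o ℓ e} (C₁ C₂ : SymMonCat o ℓ e) →
           HasAbsorbingInitial C₁ → HasAbsorbingInitial C₂ →
           (M₁ : Monoid C₁) (M₂ : Monoid C₂) →
           Σ (SymMonCat o ℓ e) (λ C → Σ (Monoid C) (λ M →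
             Σ (CentralIdem C) (λ u₁ → Σ (CentralIdem C) (λ u₂ →
               Σ (MonEquiv C u₁ C₁) (λ F₁ → MonoidCorr F₁ M M₁)
               × Σ (MonEquiv C u₂ C₂) (λ F₂ → MonoidCorr F₂ M M₂)))))
lemma5p2 C₁ C₂ H₁ H₂ M₁ M₂ =
  product C₁ C₂ , product-monoid M₁ M₂ ,
  product-idem U₁.unit-idem Z₂.zero-idem , product-idem Z₁.zero-idem U₂.unit-idem ,
  (extend-by-zeroʳ U₁.unit-restriction H₂ ,
   extend-by-zeroʳ-monoid (U₁.unit-restriction-monoid M₁) H₂ M₂) ,
  (extend-by-zeroˡ H₁ U₂.unit-restriction ,
   extend-by-zeroˡ-monoid H₁ M₁ (U₂.unit-restriction-monoid M₂))
  where
  module U₁ = UnitRestriction C₁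
  module U₂ = UnitRestriction C₂
  module Z₁ = AbsorbingInitial H₁
  module Z₂ = AbsorbingInitial H₂
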